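{- Every $X\in S$ with $X\ne(1,1,1)$ appears exactly twice in the TRIP-Stern sequence for $(e,e,e)$ (i.e. there are exactly two indices $m$ with $a_m=X$). Furthermore, for such $X$, $G(X)$ is defined and equals the unique $Y\in S$ such that $YA_0=X$ or $YA_1=X$.
   Context: Let $A_0=\begin{pmatrix}0&0&1\\1&0&0\\0&1&1\end{pmatrix}$, $A_1=\begin{pmatrix}1&0&1\\0&1&0\\0&0&1\end{pmatrix}$, so for row vectors $(x,y,z)A_0=(y,z,x+z)$ and $(x,y,z)A_1=(x,y,x+z)$. The TRIP-Stern sequence for $(e,e,e)$ is $a_1=(1,1,1)$, $a_{2n}=a_nA_0$, $a_{2n+1}=a_nA_1$ ($n\ge1$); $S$ is the set of triples occurring in it. The inverse map $G$ is the partially defined map on integer triples given by $G(a,b,c)=(a,b,c-a)$ if $a+b<c$, and $G(a,b,c)=(c-b,a,b)$ if $a+b\ge c$ and either $a<b$ or $a=1=c-b$; $G$ is undefined otherwise. -}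

module Defs where

open import Data.Nat using (ℕ; zero; suc; _+_; _≤_; _<_; ⌊_/2⌋; _≤?_)
open import Data.Integer as ℤ using (ℤ; +_)
open import Data.Product using (_×_; _,_; ∃; ∃-syntax)
open import Data.Maybe using (Maybe; just; nothing)
open import Data.Bool using (Bool; true; false; if_then_else_)
open import Relation.Nullary using (yes; no; _×-dec_; _⊎-dec_)
open import Relation.Binary.PropositionalEquality using (_≡_)

-- Row vectors (x , y , z) of natural numbers.
Triple : Set
Triple = ℕ × ℕ × ℕ

_·A₀ : Triple → Triple
(x , y , z) ·A₀ = (y , z , x + z)

_·A₁ : Triple → Triple
(x , y , z) ·A₁ = (x , y , x + z)

odd : ℕ → Bool
odd zero = false
odd (suc zero) = true
odd (suc (suc n)) = odd n

-- fuel-driven recursion (fuel m suffices for index m)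
seqF : ℕ → ℕ → Triple
seqF zero    m = (1 , 1 , 1)
seqF (suc f) m with m ≤? 1
... | yes _ = (1 , 1 , 1)
... | no  _ = if odd m then seqF f ⌊ m /2⌋ ·A₁ else seqF f ⌊ m /2⌋ ·A₀

-- TRIP-Stern sequence for (e,e,e): a 1 = (1,1,1), a (2n) = a n A₀, a (2n+1) = a n A₁
-- (only indices m ≥ 1 are meaningful; a 0 is a junk value)
a : ℕ → Triple
a m = seqF m m

InS : Triple → Set
InS X = ∃[ m ] (1 ≤ m × a m ≡ X)

ℤTriple : Set
ℤTriple = ℤ × ℤ × ℤ

toℤ : Triple → ℤTriple
toℤ (x , y , z) = (+ x , + y , + z)

G : ℤTriple → Maybe ℤTriple
G (p , q , r) with (p ℤ.+ q) ℤ.<? r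
... | yes _ = just (p , q , r ℤ.- p)
... | no  _ with (p ℤ.<? q) ⊎-dec ((p ℤ.≟ + 1) ×-dec ((r ℤ.- q) ℤ.≟ + 1))
...   | yes _ = just (r ℤ.- q , p , q)
...   | no  _ = nothing

-- Every term a m with m ≥ 2 is a child Y ·A_b of an earlier term, and every term is
-- (1,1,1) or satisfies 1 ≤ x ≤ y < z.  On such triples G undoes both A₀ and A₁, so a
-- term determines its parent; and for Y ≠ (1,1,1) the children Y ·A₀ and Y ·A₁
-- differ, so it also determines on which side it hangs.  Hence the occurrences of
-- X ≠ (1,1,1) are exactly the b-children of the occurrences of G(X), and induction
-- reduces everything to (1,1,2) = (1,1,1) ·A₀ = (1,1,1) ·A₁, which occurs at 2 and 3.
module Submission where

open import Defs
open import Data.Nat using (ℕ; zero; suc; _+_; _≤_; _<_; ⌊_/2⌋; _≤?_; z≤n; s≤s)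
open import Data.Nat.Properties
open import Data.Nat.Induction using (<-rec)
open import Data.Integer as ℤ using (+_)
import Data.Integer.Properties as ℤₚ
open import Algebra.Properties.AbelianGroup ℤₚ.+-0-abelianGroup using (xyx⁻¹≈y; //-rightDividesʳ)
open import Data.Bool using (Bool; true; false)
open import Data.Product using (_×_; _,_; ∃; ∃-syntax; proj₁; proj₂)
open import Data.Sum as Sum using (_⊎_; inj₁; inj₂)
open import Data.Maybe using (just)
open import Data.Maybe.Properties using (just-injective)
open import Data.Empty using (⊥-elim)
open import Function using (_∘_)
open import Relation.Nullary using (¬_; yes; no)
open import Relation.Binary.PropositionalEquality
  using (_≡_; _≢_; refl; sym; trans; cong; cong₂; subst; module ≡-Reasoning)

_·A[_] : Triple → Bool → Triple
Y ·A[ false ] = Y ·A₀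
Y ·A[ true  ] = Y ·A₁

·A[]-to-⊎ : ∀ {X Y} b → Y ·A[ b ] ≡ X → Y ·A₀ ≡ X ⊎ Y ·A₁ ≡ X
·A[]-to-⊎ false = inj₁
·A[]-to-⊎ true  = inj₂

·A[]-from-⊎ : ∀ {X Y} → Y ·A₀ ≡ X ⊎ Y ·A₁ ≡ X → ∃[ b ] Y ·A[ b ] ≡ X
·A[]-from-⊎ (inj₁ e) = false , e
·A[]-from-⊎ (inj₂ e) = true  , e

child : Bool → ℕ → ℕ
child false n = n + n
child true  n = suc (n + n)

child-suc : ∀ b n → child b (suc n) ≡ 2 + child b n
child-suc false n = cong suc (+-suc n n)
child-suc true  n = cong (suc ∘ suc) (+-suc n n)

odd-child : ∀ b n → odd (child b n) ≡ b
odd-child false zero    = refl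
odd-child true  zero    = refl
odd-child b     (suc n) rewrite child-suc b n = odd-child b n

⌊child/2⌋≡parent : ∀ b n → ⌊ child b n /2⌋ ≡ n
⌊child/2⌋≡parent false zero    = refl
⌊child/2⌋≡parent true  zero    = refl
⌊child/2⌋≡parent b     (suc n) rewrite child-suc b n = cong suc (⌊child/2⌋≡parent b n)

child-injectiveʳ : ∀ b {n n′} → child b n ≡ child b n′ → n ≡ n′
child-injectiveʳ b {n} {n′} e =
  trans (sym (⌊child/2⌋≡parent b n)) (trans (cong ⌊_/2⌋ e) (⌊child/2⌋≡parent b n′))

2≤child : ∀ b {n} → 1 ≤ n → 2 ≤ child b n
2≤child b {suc n} _ rewrite child-suc b n = s≤s (s≤s z≤n)

parent<child : ∀ b {n} → 1 ≤ n → n < child b n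
parent<child false {n} 1≤n = m<m+n n 1≤n
parent<child true  {n} 1≤n = m<n⇒m<1+n (m<m+n n 1≤n)

data ParentView : ℕ → Set where
  _∶_ : ∀ b n → ParentView (child b n)

parentView : ∀ m → ParentView m
parentView zero = false ∶ 0
parentView (suc m) with parentView m
... | false ∶ n = true ∶ n
... | true  ∶ n = subst ParentView (child-suc false n) (false ∶ suc n)

-- Positive binary numerals, read from the least significant bit.
data Index : ℕ → Set where
  root : Index 1
  node : ∀ b {n} → Index n → Index (child b n)

index : ∀ m → 1 ≤ m → Index m
index = <-rec (λ m → 1 ≤ m → Index m) step
  where
  step : ∀ m → (∀ {k} → k < m → 1 ≤ k → Index k) → 1 ≤ m → Index m
  step m rec 1≤m with parentView m
  ... | false ∶ zero  = ⊥-elim (<-irrefl refl 1≤m)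
  ... | true  ∶ zero  = root
  ... | b     ∶ suc n = node b (rec (parent<child b (s≤s z≤n)) (s≤s z≤n))

index⇒1≤ : ∀ {m} → Index m → 1 ≤ m
index⇒1≤ root       = s≤s z≤n
index⇒1≤ (node b i) = ≤-trans (n≤1+n 1) (2≤child b (index⇒1≤ i))

seqF-≤1 : ∀ f {m} → m ≤ 1 → seqF f m ≡ (1 , 1 , 1)
seqF-≤1 zero    m≤1 = refl
seqF-≤1 (suc f) {m} m≤1 with m ≤? 1
... | yes _   = refl
... | no  m≰1 = ⊥-elim (m≰1 m≤1)

seqF-step : ∀ f {m} → 2 ≤ m → seqF (suc f) m ≡ seqF f ⌊ m /2⌋ ·A[ odd m ]
seqF-step f {m} 2≤m with m ≤? 1
... | yes m≤1 = ⊥-elim (<⇒≱ 2≤m m≤1)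
... | no  _   with odd m
...   | false = refl
...   | true  = refl

seqF-fuel-irrelevant : ∀ {f g m} → m ≤ f → m ≤ g → seqF f m ≡ seqF g m
seqF-fuel-irrelevant {f} {g} {zero}     _ _ = trans (seqF-≤1 f z≤n) (sym (seqF-≤1 g z≤n))
seqF-fuel-irrelevant {f} {g} {suc zero} _ _ = trans (seqF-≤1 f ≤-refl) (sym (seqF-≤1 g ≤-refl))
seqF-fuel-irrelevant {suc f} {suc g} {m@(suc (suc k))} (s≤s 1+k≤f) (s≤s 1+k≤g) =
  trans (seqF-step f 2≤m)
    (trans (cong _·A[ odd m ] (seqF-fuel-irrelevant (halve 1+k≤f) (halve 1+k≤g)))
      (sym (seqF-step g 2≤m)))
  where
  2≤m : 2 ≤ m
  2≤m = s≤s (s≤s z≤n)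
  halve : ∀ {h} → suc k ≤ h → ⌊ m /2⌋ ≤ h
  halve = ≤-trans (≤-pred (⌊n/2⌋<n (suc k)))

a-step : ∀ {m} → 2 ≤ m → a m ≡ a ⌊ m /2⌋ ·A[ odd m ]
a-step {suc m} 2≤m =
  trans (seqF-step m 2≤m)
    (cong _·A[ odd (suc m) ] (seqF-fuel-irrelevant (≤-pred (⌊n/2⌋<n m)) ≤-refl))

a-child : ∀ b {n} → 1 ≤ n → a (child b n) ≡ a n ·A[ b ]
a-child b {n} 1≤n =
  trans (a-step (2≤child b 1≤n))
    (cong₂ (λ k c → a k ·A[ c ]) (⌊child/2⌋≡parent b n) (odd-child b n))

Increasing : Triple → Set
Increasing (x , y , z) = 1 ≤ x × x ≤ y × y < z

data Ordered : Triple → Set where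
  unit       : Ordered (1 , 1 , 1)
  increasing : ∀ {X} → Increasing X → Ordered X

increasing⇒≢unit : ∀ {X} → Increasing X → X ≢ (1 , 1 , 1)
increasing⇒≢unit (_ , _ , y<z) refl = <-irrefl refl y<z

·A-increasing : ∀ b {Y} → Ordered Y → Increasing (Y ·A[ b ])
·A-increasing false unit = s≤s z≤n , s≤s z≤n , s≤s (s≤s z≤n)
·A-increasing true  unit = s≤s z≤n , s≤s z≤n , s≤s (s≤s z≤n)
·A-increasing false (increasing {x , y , z} (1≤x , x≤y , y<z)) =
  ≤-trans 1≤x x≤y , <⇒≤ y<z , m<n+m z 1≤x
·A-increasing true  (increasing {x , y , z} (1≤x , x≤y , y<z)) =
  1≤x , x≤y , ≤-trans y<z (m≤n+m z x)

·A[]-injectiveʳ : ∀ {Y} b b′ → Increasing Y → Y ·A[ b ] ≡ Y ·A[ b′ ] → b ≡ b′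
·A[]-injectiveʳ false false _             _ = refl
·A[]-injectiveʳ true  true  _             _ = refl
·A[]-injectiveʳ false true  (_ , _ , y<z) e = ⊥-elim (<⇒≢ y<z (sym (cong (proj₁ ∘ proj₂) e)))
·A[]-injectiveʳ true  false (_ , _ , y<z) e = ⊥-elim (<⇒≢ y<z (cong (proj₁ ∘ proj₂) e))

a-ordered : ∀ {m} → Index m → Ordered (a m)
a-child-increasing : ∀ b {n} → Index n → Increasing (a (child b n))

a-ordered root       = unit
a-ordered (node b i) = increasing (a-child-increasing b i)

a-child-increasing b i =
  subst Increasing (sym (a-child b (index⇒1≤ i))) (·A-increasing b (a-ordered i))

a≡unit⇒root : ∀ {m} → Index m → a m ≡ (1 , 1 , 1) → m ≡ 1
a≡unit⇒root root       _ = refl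
a≡unit⇒root (node b i) e = ⊥-elim (increasing⇒≢unit (a-child-increasing b i) e)

G-< : ∀ p q r → p ℤ.+ q ℤ.< r → G (p , q , r) ≡ just (p , q , r ℤ.- p)
G-< p q r p+q<r with (p ℤ.+ q) ℤ.<? r
... | yes _     = refl
... | no  p+q≮r = ⊥-elim (p+q≮r p+q<r)

G-≮-< : ∀ p q r → ¬ (p ℤ.+ q ℤ.< r) → p ℤ.< q → G (p , q , r) ≡ just (r ℤ.- q , p , q)
G-≮-< p q r p+q≮r p<q with (p ℤ.+ q) ℤ.<? r
... | yes p+q<r = ⊥-elim (p+q≮r p+q<r)
... | no  _     with p ℤ.<? q
...   | yes _   = refl
...   | no  p≮q = ⊥-elim (p≮q p<q)

G-·A : ∀ b {Y} → Ordered Y → G (toℤ (Y ·A[ b ])) ≡ just (toℤ Y)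
G-·A false unit = refl
G-·A true  unit = refl
G-·A false (increasing {x , y , z} (_ , x≤y , y<z)) =
  trans (G-≮-< (+ y) (+ z) (+ (x + z)) (≤⇒≯ (+-monoˡ-≤ z x≤y) ∘ ℤₚ.drop‿+<+) (ℤ.+<+ y<z))
        (cong (λ w → just (w , + y , + z)) (//-rightDividesʳ (+ z) (+ x)))
G-·A true  (increasing {x , y , z} (_ , _ , y<z)) =
  trans (G-< (+ x) (+ y) (+ (x + z)) (ℤ.+<+ (+-monoʳ-< x y<z)))
        (cong (λ w → just (+ x , + y , w)) (xyx⁻¹≈y (+ x) (+ z)))

toℤ-injective : ∀ {X Y} → toℤ X ≡ toℤ Y → X ≡ Y
toℤ-injective {_ , _ , _} {_ , _ , _} refl = refl

·A-injective : ∀ {Y Y′} b b′ → Ordered Y → Ordered Y′ → Y ·A[ b ] ≡ Y′ ·A[ b′ ] → Y ≡ Y′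
·A-injective {Y} {Y′} b b′ oY oY′ e = toℤ-injective (just-injective (begin
  just (toℤ Y)             ≡⟨ sym (G-·A b oY) ⟩
  G (toℤ (Y ·A[ b ]))      ≡⟨ cong (G ∘ toℤ) e ⟩
  G (toℤ (Y′ ·A[ b′ ]))    ≡⟨ G-·A b′ oY′ ⟩
  just (toℤ Y′)            ∎))
  where open ≡-Reasoning

a-child-preimage : ∀ b {n m} → Index n → 1 ≤ m → a m ≡ a (child b n) →
  ∃[ b′ ] ∃[ k ] (Index k × m ≡ child b′ k × a k ≡ a n × a n ·A[ b′ ] ≡ a n ·A[ b ])
a-child-preimage b {n} {m} i 1≤m e with index m 1≤m
... | root = ⊥-elim (increasing⇒≢unit (a-child-increasing b i) (sym e))
... | node b′ {k} j =
  b′ , k , j , refl , a-k≡a-n , subst (λ Y → Y ·A[ b′ ] ≡ a n ·A[ b ]) a-k≡a-n parents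
  where
  parents : a k ·A[ b′ ] ≡ a n ·A[ b ]
  parents = trans (sym (a-child b′ (index⇒1≤ j))) (trans e (a-child b (index⇒1≤ i)))
  a-k≡a-n : a k ≡ a n
  a-k≡a-n = ·A-injective b′ b (a-ordered j) (a-ordered i) parents

a≡a2⇒2⊎3 : ∀ {m} → 1 ≤ m → a m ≡ a 2 → m ≡ 2 ⊎ m ≡ 3
a≡a2⇒2⊎3 1≤m e with a-child-preimage false root 1≤m e
... | b′ , k , j , refl , a-k≡a-1 , _ with a≡unit⇒root j a-k≡a-1
a≡a2⇒2⊎3 _ _ | false , _ , _ , refl , _ , _ | refl = inj₁ refl
a≡a2⇒2⊎3 _ _ | true  , _ , _ , refl , _ , _ | refl = inj₂ refl

HasTwin : ℕ → Set
HasTwin m = ∃[ m′ ] (m′ ≢ m × 1 ≤ m′ × a m′ ≡ a m ×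
  ((m″ : ℕ) → 1 ≤ m″ → a m″ ≡ a m → m″ ≡ m ⊎ m″ ≡ m′))

twin : ∀ b {n} → Index n → HasTwin (child b n)
twin false root = 3 , (λ ()) , s≤s z≤n , refl , λ _ → a≡a2⇒2⊎3
twin true  root = 2 , (λ ()) , s≤s z≤n , refl , λ _ 1≤m e → Sum.swap (a≡a2⇒2⊎3 1≤m e)
twin b (node c {n₀} i) with twin c i
... | n′ , n′≢n , 1≤n′ , a-n′≡a-n , n-twins =
  child b n′ , n′≢n ∘ child-injectiveʳ b , ≤-trans (n≤1+n 1) (2≤child b 1≤n′) , same , twins
  where
  n = child c n₀
  same : a (child b n′) ≡ a (child b n)
  same = begin
    a (child b n′)  ≡⟨ a-child b 1≤n′ ⟩
    a n′ ·A[ b ]    ≡⟨ cong _·A[ b ] a-n′≡a-n ⟩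
    a n ·A[ b ]     ≡⟨ sym (a-child b (index⇒1≤ (node c i))) ⟩
    a (child b n)   ∎
    where open ≡-Reasoning
  twins : ∀ m″ → 1 ≤ m″ → a m″ ≡ a (child b n) → m″ ≡ child b n ⊎ m″ ≡ child b n′
  twins m″ 1≤m″ e with a-child-preimage b (node c i) 1≤m″ e
  ... | b′ , k , j , refl , a-k≡a-n , sides with ·A[]-injectiveʳ b′ b (a-child-increasing c i) sides
  ...   | refl = Sum.map (cong (child b)) (cong (child b)) (n-twins k (index⇒1≤ j) a-k≡a-n)

corollary31 : (X : Triple) → InS X → X ≢ (1 , 1 , 1) →
    (∃[ m₁ ] ∃[ m₂ ] (m₁ ≢ m₂ × 1 ≤ m₁ × 1 ≤ m₂ × a m₁ ≡ X × a m₂ ≡ X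
        × ((m : ℕ) → 1 ≤ m → a m ≡ X → (m ≡ m₁ ⊎ m ≡ m₂))))
    × (∃[ Y ] (InS Y × (Y ·A₀ ≡ X ⊎ Y ·A₁ ≡ X)
        × ((Y′ : Triple) → InS Y′ → (Y′ ·A₀ ≡ X ⊎ Y′ ·A₁ ≡ X) → Y′ ≡ Y)
        × G (toℤ X) ≡ just (toℤ Y)))
corollary31 X (m , 1≤m , a-m≡X) X≢unit with index m 1≤m
... | root = ⊥-elim (X≢unit (sym a-m≡X))
... | node b {n} i with twin b i
...   | m′ , m′≢m , 1≤m′ , a-m′≡a-m , twins =
  (child b n , m′ , m′≢m ∘ sym , 1≤m , 1≤m′ , a-m≡X , trans a-m′≡a-m a-m≡X ,
     λ m″ 1≤m″ e → twins m″ 1≤m″ (trans e (sym a-m≡X))) ,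
  (a n , (n , index⇒1≤ i , refl) , ·A[]-to-⊎ b parent , unique ,
     subst (λ Z → G (toℤ Z) ≡ just (toℤ (a n))) parent (G-·A b (a-ordered i)))
  where
  parent : a n ·A[ b ] ≡ X
  parent = trans (sym (a-child b (index⇒1≤ i))) a-m≡X
  unique : (Y′ : Triple) → InS Y′ → (Y′ ·A₀ ≡ X ⊎ Y′ ·A₁ ≡ X) → Y′ ≡ a n
  unique Y′ (j , 1≤j , a-j≡Y′) p′ with ·A[]-from-⊎ p′
  ... | b′ , e′ = ·A-injective b′ b (subst Ordered a-j≡Y′ (a-ordered (index j 1≤j))) (a-ordered i)
                    (trans e′ (sym parent))
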